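{- Let $g,n\ge0$ with $3g-3+n>0$. For each $i$ with $1\le i\le 2g-2+n$, the subcomplex $\mathsf V^i_{g,n}$ is pure of dimension $g+i-2$. Moreover $\mathsf V^{2g-2+n}_{g,n}=\Delta_{g,n}$.
   Context: $I_n=\{1,\dots,n\}$; $[p]=\{0,\dots,p\}$, $[-1]=\emptyset$. A graph $G$ is a finite set $X(G)=V(G)\sqcup H(G)$ with maps $s,r$ ($s^2=\mathrm{id}$, $r^2=r$, both with fixed-point set $V(G)$); $r$ gives the vertex of a half-edge, edges are $s$-orbits in $H(G)$ (loops, multiple edges allowed); graphs are connected, $b^1(G)=|E|-|V|+1$, $\mathrm{val}(v)$ = number of half-edges at $v$. A stable $n$-marked weighted graph of genus $g$ is $\mathbf G=(G,w,m)$, $w:V\to\mathbb Z_{\ge0}$, $m:I_n\to V$, with $b^1(G)+\sum w(v)=g$ and $2w(v)-2+\mathrm{val}(v)+|m^{ -1}(v)|>0$ for all $v$; isomorphisms preserve $r,s,w,m$. Contracting a loop deletes it and adds 1 to its vertex weight; contracting a non-loop edge merges its endpoints (weights summed, markings united). An edge-labelled pair $(\mathbf G,\tau)$ has $\tau:E(\mathbf G)\to[p]$ a bijection; pairs are isomorphic if an isomorphism respects labels; $[\mathbf G,\tau]$ is the class. $\Delta_{g,n}$ is the contravariant functor on the category $\mathrm I$ (objects $[p]$, $p\ge-1$; morphisms injections) with $\Delta_{g,n}[p]=\{[\mathbf G,\tau]:|E(\mathbf G)|=p+1\}$ and, for injective $\iota:[p]\to[q]$, $\Delta_{g,n}(\iota)[\mathbf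 G,\tau]$ obtained by contracting edges with labels outside $\iota([p])$ and relabelling remaining edges by $\iota^{ -1}\circ\tau$. $\mathsf V^i_{g,n}$ is the subfunctor with $\mathsf V^i_{g,n}[p]=\{[\mathbf G,\tau]\in\Delta_{g,n}[p]:|V(\mathbf G)|\le i\}$. For a functor $X:\mathrm I^{op}\to\mathsf{Set}$, an element $\xi\in X[p]$ is a facet if it is not in the image of $X(\delta^j):X[p+1]\to X[p]$ for any $j\in[p+1]$, where $\delta^j:[p]\to[p+1]$ is the order-preserving injection missing $j$; $X$ is pure of dimension $d$ if all facets lie in $X[d]$. -}

module Defs where

open import Data.Nat using (ℕ; zero; suc; _+_; _*_; _∸_; _≤_; _<_)
open import Data.Fin using (Fin; zero; suc; punchIn; punchOut; _≟_)
open import Data.Bool using (if_then_else_)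
open import Data.Product using (Σ; _×_; _,_; proj₁; proj₂; ∃)
open import Data.Sum using (_⊎_)
open import Data.Integer as ℤ using (ℤ; +_)
open import Relation.Nullary using (¬_; yes; no)
open import Relation.Nullary.Decidable using (⌊_⌋)
open import Relation.Binary.PropositionalEquality using (_≡_; _≢_; sym)
open import Function using (_∘_)
open import Function.Bundles using (_↔_; Inverse)

sumF : ∀ {k} → (Fin k → ℕ) → ℕ
sumF {zero}  f = 0
sumF {suc k} f = f zero + sumF (λ i → f (suc i))

[_≟ᶠ_] : ∀ {k} → Fin k → Fin k → ℕ
[ a ≟ᶠ b ] = if ⌊ a ≟ b ⌋ then 1 else 0

-- Raw n-marked weighted graphs with edges labelled bijectively by Fin e
-- (label set [p] with p + 1 = e).  Edge k has two half-edges, attached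
-- at  src k  and  tgt k  (a loop when src k = tgt k).

record RawGraph (n e : ℕ) : Set where
  field
    nv  : ℕ
    src : Fin e → Fin nv
    tgt : Fin e → Fin nv
    w   : Fin nv → ℕ
    m   : Fin n → Fin nv
open RawGraph public

val : ∀ {n e} (G : RawGraph n e) → Fin (nv G) → ℕ
val G v = sumF (λ k → [ src G k ≟ᶠ v ] + [ tgt G k ≟ᶠ v ])

marks : ∀ {n e} (G : RawGraph n e) → Fin (nv G) → ℕ
marks G v = sumF (λ j → [ m G j ≟ᶠ v ])

data Reach {nv e : ℕ} (src tgt : Fin e → Fin nv) : Fin nv → Fin nv → Set where
  here : ∀ {a} → Reach src tgt a a
  fwd  : ∀ {b} (k : Fin e) → Reach src tgt (tgt k) b → Reach src tgt (src k) b
  bwd  : ∀ {b} (k : Fin e) → Reach src tgt (src k) b → Reach src tgt (tgt k) b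

Connected : ∀ {n e} → RawGraph n e → Set
Connected G = 1 ≤ nv G × (∀ a b → Reach (src G) (tgt G) a b)

-- Genus condition  b¹(G) + Σ w = g  with  b¹ = e - |V| + 1, written without subtraction.
-- Stability  2w(v) - 2 + val(v) + |m⁻¹(v)| > 0, i.e.  2w(v)+val(v)+|m⁻¹(v)| ≥ 3.
record StableGraph (g n e : ℕ) : Set where
  field
    raw       : RawGraph n e
    connected : Connected raw
    genus     : e + 1 + sumF (w raw) ≡ g + nv raw
    stable    : ∀ v → 3 ≤ 2 * w raw v + val raw v + marks raw v
open StableGraph public

-- Isomorphism of edge-labelled graphs: a vertex bijection σ preserving
-- weights and markings; each edge goes to the edge with the same label,
-- its two half-edges going either straight or swapped.

record Iso {n e : ℕ} (G H : RawGraph n e) : Set where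
  field
    σ       : Fin (nv G) ↔ Fin (nv H)
    weight  : ∀ v → w H (Inverse.to σ v) ≡ w G v
    marking : ∀ j → m H j ≡ Inverse.to σ (m G j)
    edges   : ∀ k → (src H k ≡ Inverse.to σ (src G k) × tgt H k ≡ Inverse.to σ (tgt G k))
                  ⊎ (src H k ≡ Inverse.to σ (tgt G k) × tgt H k ≡ Inverse.to σ (src G k))

-- identify b with a ≠ b (vertex set shrinks by one)
merge : ∀ {k} (a b : Fin (suc k)) → a ≢ b → Fin (suc k) → Fin k
merge a b ne v with v ≟ b
... | yes _   = punchOut {i = b} {j = a} (λ e → ne (sym e))
... | no v≢b  = punchOut {i = b} {j = v} (λ e → v≢b (sym e))

mergeAny : ∀ {nv} (a b : Fin nv) → a ≢ b → Σ ℕ (λ k → Fin nv → Fin k)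
mergeAny {suc k} a b ne = k , merge a b ne

-- Δ(δʲ): contract the edge labelled j and relabel the remaining edges
-- by (δʲ)⁻¹, where δʲ = punchIn j : Fin e → Fin (suc e) misses j.
faceMap : ∀ {n e} → Fin (suc e) → RawGraph n (suc e) → RawGraph n e
faceMap j G with src G j ≟ tgt G j
... | yes _ = record
  { nv  = nv G
  ; src = src G ∘ punchIn j
  ; tgt = tgt G ∘ punchIn j
  ; w   = λ u → w G u + [ src G j ≟ᶠ u ]
  ; m   = m G }
... | no ne = record
  { nv  = proj₁ M
  ; src = φ ∘ src G ∘ punchIn j
  ; tgt = φ ∘ tgt G ∘ punchIn j
  ; w   = λ u → sumF (λ v → if ⌊ φ v ≟ u ⌋ then w G v else 0)
  ; m   = φ ∘ m G }
  where
    M = mergeAny (src G j) (tgt G j) ne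
    φ = proj₂ M

-- The subfunctor Vⁱ_{g,n}: elements of Vⁱ[p] are (classes of) stable
-- graphs with p + 1 edges and at most i vertices.

InV : ∀ {g n e} → ℕ → StableGraph g n e → Set
InV i G = nv (raw G) ≤ i

-- G ∈ Vⁱ[p] (p + 1 = e) is a facet of Vⁱ: not in the image of
-- Vⁱ(δʲ) : Vⁱ[p+1] → Vⁱ[p] for any j ∈ [p+1].
FacetV : ∀ {g n e} → ℕ → StableGraph g n e → Set
FacetV {g} {n} {e} i G =
  ¬ (Σ (Fin (suc e)) λ j → Σ (StableGraph g n (suc e)) λ H →
       InV i H × Iso (faceMap j (raw H)) (raw G))

-- Vⁱ_{g,n} is pure of dimension d (d ∈ ℤ, d ≥ -1): every facet lies in
-- Vⁱ[d], i.e. has p = e - 1 = d.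
PureV : ℕ → ℕ → ℕ → ℤ → Set
PureV g n i d = ∀ e (G : StableGraph g n e) → InV i G → FacetV i G →
                (+ e) ℤ.- + 1 ≡ d

module Submission where

-- Both parts rest on one count.  Summing the stability inequality over the
-- vertices and using the degree-sum formula Σ val = 2|E|, Σ |m⁻¹(v)| = n and
-- the genus formula |E| + 1 + Σ w = g + |V| gives
--     3|V| ≤ 2 Σ w + 2|E| + n = 2(g + |V| - 1) + n,   i.e.  |V| ≤ 2g - 2 + n.
-- For purity let G be a facet of Vⁱ.  A vertex of positive weight can be
-- "blown up": lower its weight by one and attach a new loop; contracting the
-- loop returns G, and no vertex was added, so G would not be a facet.  Hence
-- all weights vanish.  If G had fewer than i vertices, the same count for a
-- graph with one vertex more yields (pigeonhole) a vertex v with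
-- val(v) + |m⁻¹(v)| ≥ 4; moving two of its half-edges or markings to a new
-- vertex joined to v by a new edge gives a stable graph in Vⁱ contracting to
-- G, again impossible.  So |V| = i, and the genus formula gives |E| - 1 = g + i - 2.

open import Defs
open import Data.Nat using (ℕ; _+_; _*_; _∸_; _≤_; _<_)
open import Data.Integer as ℤ using (+_)
open import Data.Product using (_×_)

open import Data.Nat using (zero; suc; z≤n; s≤s)
open import Data.Nat.Properties hiding (_≟_; suc-injective)
open import Data.Nat.Solver using (module +-*-Solver)
open import Data.Fin using (Fin; zero; suc; _≟_; punchIn)
open import Data.Fin.Properties using (suc-injective)
open import Data.Vec.Functional using (_∷_)
open import Data.Bool using (Bool; true; false; if_then_else_)
open import Data.Bool.Properties using (if-eta)
open import Data.Product using (Σ; _,_; proj₁; proj₂)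
open import Data.Sum using (_⊎_; inj₁; inj₂)
open import Data.Empty using (⊥-elim)
open import Relation.Nullary using (yes; no)
open import Relation.Nullary.Decidable using (⌊_⌋)
open import Relation.Binary.PropositionalEquality
open import Function using (_∘_)
open import Function.Construct.Identity using (↔-id)
import Data.Integer.Properties as ℤP
open import Algebra.Properties.CommutativeSemigroup +-commutativeSemigroup
  using () renaming (interchange to +-interchange)

open +-*-Solver using (solve; _:+_; _:*_; _:=_; con)

sumF-cong : ∀ {k} {f g : Fin k → ℕ} → (∀ i → f i ≡ g i) → sumF f ≡ sumF g
sumF-cong {zero}  eq = refl
sumF-cong {suc k} eq = cong₂ _+_ (eq zero) (sumF-cong (λ i → eq (suc i)))

sumF-zero : ∀ {k} (f : Fin k → ℕ) → (∀ i → f i ≡ 0) → sumF f ≡ 0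
sumF-zero {zero}  f eq = refl
sumF-zero {suc k} f eq rewrite eq zero = sumF-zero (λ i → f (suc i)) (λ i → eq (suc i))

sumF-+ : ∀ {k} (f g : Fin k → ℕ) → sumF (λ i → f i + g i) ≡ sumF f + sumF g
sumF-+ {zero}  f g = refl
sumF-+ {suc k} f g rewrite sumF-+ (λ i → f (suc i)) (λ i → g (suc i)) =
  +-interchange (f zero) (g zero) _ _

sumF-*ˡ : ∀ {k} c (f : Fin k → ℕ) → sumF (λ i → c * f i) ≡ c * sumF f
sumF-*ˡ {zero}  c f = sym (*-zeroʳ c)
sumF-*ˡ {suc k} c f rewrite sumF-*ˡ c (λ i → f (suc i)) = sym (*-distribˡ-+ c (f zero) _)

sumF-const : ∀ {k} c → sumF {k} (λ _ → c) ≡ k * c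
sumF-const {zero}  c = refl
sumF-const {suc k} c = cong (λ x → c + x) (sumF-const {k} c)

sumF-swap : ∀ {a b} (h : Fin a → Fin b → ℕ) →
  sumF (λ i → sumF (h i)) ≡ sumF (λ j → sumF (λ i → h i j))
sumF-swap {zero}  {b} h = sym (sumF-zero {b} (λ _ → 0) (λ _ → refl))
sumF-swap {suc a} {b} h =
  trans (cong (λ x → sumF (h zero) + x) (sumF-swap (λ i → h (suc i))))
        (sym (sumF-+ (h zero) (λ j → sumF (λ i → h (suc i) j))))

sumF-≥ : ∀ {k} c (f : Fin k → ℕ) → (∀ i → c ≤ f i) → k * c ≤ sumF f
sumF-≥ {zero}  c f h = z≤n
sumF-≥ {suc k} c f h = +-mono-≤ (h zero) (sumF-≥ c _ (λ i → h (suc i)))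

sumF-pigeonhole : ∀ {k} c (f : Fin k → ℕ) → k * c < sumF f → Σ (Fin k) λ i → c < f i
sumF-pigeonhole {zero}  c f ()
sumF-pigeonhole {suc k} c f lt with c <? f zero
... | yes c<f0 = zero , c<f0
... | no  c≮f0 =
  let (i , c<fi) = sumF-pigeonhole c (λ i → f (suc i)) tail-lt in suc i , c<fi
  where
  tail-lt : k * c < sumF (λ i → f (suc i))
  tail-lt = +-cancelˡ-< c (k * c) _
              (<-≤-trans lt (+-monoˡ-≤ (sumF (λ i → f (suc i))) (≮⇒≥ c≮f0)))

ind-yes : ∀ {k} {a b : Fin k} → a ≡ b → [ a ≟ᶠ b ] ≡ 1
ind-yes {a = a} {b} a≡b with a ≟ b
... | yes _   = refl
... | no  a≢b = ⊥-elim (a≢b a≡b)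

ind-no : ∀ {k} {a b : Fin k} → a ≢ b → [ a ≟ᶠ b ] ≡ 0
ind-no {a = a} {b} a≢b with a ≟ b
... | yes a≡b = ⊥-elim (a≢b a≡b)
... | no  _   = refl

ind-cases : ∀ {k} (a b : Fin k) → ([ a ≟ᶠ b ] ≡ 0 × a ≢ b) ⊎ ([ a ≟ᶠ b ] ≡ 1 × a ≡ b)
ind-cases a b with a ≟ b
... | yes a≡b = inj₂ (refl , a≡b)
... | no  a≢b = inj₁ (refl , a≢b)

ind-suc : ∀ {k} (a b : Fin k) → [ suc a ≟ᶠ suc b ] ≡ [ a ≟ᶠ b ]
ind-suc a b with ind-cases a b
... | inj₁ (eq , a≢b) = trans (ind-no (λ sa≡sb → a≢b (suc-injective sa≡sb))) (sym eq)
... | inj₂ (eq , a≡b) = trans (ind-yes (cong suc a≡b)) (sym eq)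

sumF-ind : ∀ {k} (a : Fin k) → sumF (λ v → [ a ≟ᶠ v ]) ≡ 1
sumF-ind {suc k} zero    = cong suc (sumF-zero {k} (λ v → [ zero ≟ᶠ suc v ]) (λ _ → refl))
sumF-ind         (suc a) = trans (sumF-cong (ind-suc a)) (sumF-ind a)

sumF-val : ∀ {n e} (G : RawGraph n e) → sumF (val G) ≡ e * 2
sumF-val {n} {e} G = begin
  sumF (λ v → sumF (λ k → [ src G k ≟ᶠ v ] + [ tgt G k ≟ᶠ v ]))
    ≡⟨ sumF-swap (λ v k → [ src G k ≟ᶠ v ] + [ tgt G k ≟ᶠ v ]) ⟩
  sumF (λ k → sumF (λ v → [ src G k ≟ᶠ v ] + [ tgt G k ≟ᶠ v ]))
    ≡⟨ sumF-cong two-ends ⟩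
  sumF {e} (λ _ → 2)
    ≡⟨ sumF-const {e} 2 ⟩
  e * 2 ∎
  where
  open ≡-Reasoning
  two-ends : ∀ k → sumF (λ v → [ src G k ≟ᶠ v ] + [ tgt G k ≟ᶠ v ]) ≡ 2
  two-ends k = trans (sumF-+ (λ v → [ src G k ≟ᶠ v ]) (λ v → [ tgt G k ≟ᶠ v ]))
                     (cong₂ _+_ (sumF-ind (src G k)) (sumF-ind (tgt G k)))

sumF-marks : ∀ {n e} (G : RawGraph n e) → sumF (marks G) ≡ n
sumF-marks {n} G = begin
  sumF (λ v → sumF (λ j → [ m G j ≟ᶠ v ]))  ≡⟨ sumF-swap (λ v j → [ m G j ≟ᶠ v ]) ⟩
  sumF (λ j → sumF (λ v → [ m G j ≟ᶠ v ]))  ≡⟨ sumF-cong (λ j → sumF-ind (m G j)) ⟩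
  sumF {n} (λ _ → 1)                         ≡⟨ sumF-const {n} 1 ⟩
  n * 1                                      ≡⟨ *-identityʳ n ⟩
  n ∎
  where open ≡-Reasoning

sumF-stability : ∀ {n e} (R : RawGraph n e) →
  sumF (λ v → 2 * w R v + val R v + marks R v) ≡ 2 * sumF (w R) + e * 2 + n
sumF-stability {n} {e} R = begin
  sumF (λ v → 2 * w R v + val R v + marks R v)
    ≡⟨ sumF-+ (λ v → 2 * w R v + val R v) (marks R) ⟩
  sumF (λ v → 2 * w R v + val R v) + sumF (marks R)
    ≡⟨ cong (λ x → x + sumF (marks R)) (sumF-+ (λ v → 2 * w R v) (val R)) ⟩
  sumF (λ v → 2 * w R v) + sumF (val R) + sumF (marks R)
    ≡⟨ cong₂ (λ x y → x + y + sumF (marks R)) (sumF-*ˡ 2 (w R)) (sumF-val R) ⟩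
  2 * sumF (w R) + e * 2 + sumF (marks R)
    ≡⟨ cong (λ x → 2 * sumF (w R) + e * 2 + x) (sumF-marks R) ⟩
  2 * sumF (w R) + e * 2 + n ∎
  where open ≡-Reasoning

-- The vertex bound |V| ≤ 2g - 2 + n, from 3|V| ≤ Σ (stability quantity).
vertexBound : ∀ {g n e} (G : StableGraph g n e) → nv (raw G) + 2 ≤ 2 * g + n
vertexBound {g} {n} {e} G = +-cancelˡ-≤ (2 * N) (N + 2) (2 * g + n) (begin
  2 * N + (N + 2)         ≡⟨ solve 1 (λ x → con 2 :* x :+ (x :+ con 2) := x :* con 3 :+ con 2) refl N ⟩
  N * 3 + 2               ≤⟨ +-monoˡ-≤ 2 three-per-vertex ⟩
  2 * W + e * 2 + n + 2   ≡⟨ solve 3 (λ W e n → con 2 :* W :+ e :* con 2 :+ n :+ con 2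
                                               := con 2 :* (e :+ con 1 :+ W) :+ n) refl W e n ⟩
  2 * (e + 1 + W) + n     ≡⟨ cong (λ x → 2 * x + n) (genus G) ⟩
  2 * (g + N) + n         ≡⟨ solve 3 (λ g x n → con 2 :* (g :+ x) :+ n
                                             := con 2 :* x :+ (con 2 :* g :+ n)) refl g N n ⟩
  2 * N + (2 * g + n)     ∎)
  where
  open ≤-Reasoning
  R : RawGraph n e
  R = raw G
  N W : ℕ
  N = nv R
  W = sumF (w R)
  three-per-vertex : N * 3 ≤ 2 * W + e * 2 + n
  three-per-vertex = subst (N * 3 ≤_) (sumF-stability R) (sumF-≥ 3 _ (stable G))

Reach-trans : ∀ {N e} {s t : Fin e → Fin N} {a b c} →
  Reach s t a b → Reach s t b c → Reach s t a c
Reach-trans here      q = q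
Reach-trans (fwd k p) q = fwd k (Reach-trans p q)
Reach-trans (bwd k p) q = bwd k (Reach-trans p q)

faceMap-loop : ∀ {n e} (j : Fin (suc e)) (G : RawGraph n (suc e)) → src G j ≡ tgt G j →
  faceMap j G ≡ record
    { nv  = nv G
    ; src = src G ∘ punchIn j
    ; tgt = tgt G ∘ punchIn j
    ; w   = λ u → w G u + [ src G j ≟ᶠ u ]
    ; m   = m G }
faceMap-loop j G loop with src G j ≟ tgt G j
... | yes _    = refl
... | no  ¬loop = ⊥-elim (¬loop loop)

-- Trading c ≤ a units of weight for c loops (2c half-edges) leaves the
-- stability quantity 2w + val + |m⁻¹| unchanged.
weight-to-loops : ∀ a b d c → c ≤ a → 2 * (a ∸ c) + ((c + c) + b) + d ≡ 2 * a + b + d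
weight-to-loops a b d c c≤a = begin
  2 * (a ∸ c) + ((c + c) + b) + d
    ≡⟨ solve 4 (λ x c b d → con 2 :* x :+ ((c :+ c) :+ b) :+ d := con 2 :* (x :+ c) :+ b :+ d)
             refl (a ∸ c) c b d ⟩
  2 * (a ∸ c + c) + b + d
    ≡⟨ cong (λ x → 2 * x + b + d) (m∸n+n≡m c≤a) ⟩
  2 * a + b + d ∎
  where open ≡-Reasoning

-- A vertex v of positive weight can be blown up: the graph H with w(v)
-- lowered by one and a new loop at v, labelled 0, is stable of the same
-- genus, has the same vertices, and contracting its loop gives back G.
module LoopBlowUp {g n e : ℕ} (G : StableGraph g n e) (v : Fin (nv (raw G)))
                  (w-pos : 1 ≤ w (raw G) v) where
  private
    R : RawGraph n e
    R = raw G

  -- the weight moved from each vertex u to the new loop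
  moved : Fin (nv R) → ℕ
  moved u = [ v ≟ᶠ u ]

  moved≤w : ∀ u → moved u ≤ w R u
  moved≤w u with ind-cases v u
  ... | inj₁ (eq , _)    rewrite eq = z≤n
  ... | inj₂ (eq , refl) rewrite eq = w-pos

  rawH : RawGraph n (suc e)
  rawH = record
    { nv = nv R ; src = v ∷ src R ; tgt = v ∷ tgt R
    ; w = λ u → w R u ∸ moved u ; m = m R }

  -- Old edges keep their ends (relabelled k ↦ suc k), so paths survive.
  reach-lift : ∀ {a b} → Reach (src R) (tgt R) a b → Reach (src rawH) (tgt rawH) a b
  reach-lift here      = here
  reach-lift (fwd k r) = fwd (suc k) (reach-lift r)
  reach-lift (bwd k r) = bwd (suc k) (reach-lift r)

  -- The total weight dropped by exactly one, matching the extra edge.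
  weight-drop : sumF (w rawH) + 1 ≡ sumF (w R)
  weight-drop = begin
    sumF (w rawH) + 1                ≡⟨ cong (λ x → sumF (w rawH) + x) (sym (sumF-ind v)) ⟩
    sumF (w rawH) + sumF moved       ≡⟨ sym (sumF-+ (w rawH) moved) ⟩
    sumF (λ u → w R u ∸ moved u + moved u) ≡⟨ sumF-cong (λ u → m∸n+n≡m (moved≤w u)) ⟩
    sumF (w R) ∎
    where open ≡-Reasoning

  H : StableGraph g n (suc e)
  H = record
    { raw       = rawH
    ; connected = proj₁ (connected G) , λ a b → reach-lift (proj₂ (connected G) a b)
    ; genus     = begin
        suc e + 1 + sumF (w rawH)   ≡⟨ solve 2 (λ e s → con 1 :+ e :+ con 1 :+ s
                                                      := e :+ con 1 :+ (s :+ con 1)) refl e (sumF (w rawH)) ⟩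
        e + 1 + (sumF (w rawH) + 1) ≡⟨ cong (λ x → e + 1 + x) weight-drop ⟩
        e + 1 + sumF (w R)          ≡⟨ genus G ⟩
        g + nv R ∎
    ; stable    = λ u → subst (3 ≤_)
        (sym (weight-to-loops (w R u) (val R u) (marks R u) (moved u) (moved≤w u))) (stable G u) }
    where open ≡-Reasoning

  contracts : Iso (faceMap zero rawH) R
  contracts = subst (λ X → Iso X R) (sym (faceMap-loop zero rawH refl)) record
    { σ       = ↔-id _
    ; weight  = λ u → sym (m∸n+n≡m (moved≤w u))
    ; marking = λ _ → refl
    ; edges   = λ _ → inj₁ (refl , refl) }

-- Selections of half-edges and markings, as Boolean families.

bi : Bool → ℕ
bi b = if b then 1 else 0

count : ∀ {k} → (Fin k → Bool) → ℕ
count b = sumF (λ i → bi (b i))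

_⊆ᵇ_ : ∀ {k} → (Fin k → Bool) → (Fin k → Bool) → Set
s ⊆ᵇ b = ∀ i → s i ≡ true → b i ≡ true

select : ∀ {k} (b : Fin k → Bool) t → t ≤ count b →
  Σ (Fin k → Bool) λ s → s ⊆ᵇ b × count s ≡ t
select {zero} b .0 z≤n = (λ ()) , (λ ()) , refl
select {suc k} b t t≤ with b zero in b0
select {suc k} b zero    _         | true =
  (λ _ → false) , (λ _ ()) , sumF-zero {suc k} (λ _ → 0) (λ _ → refl)
select {suc k} b (suc t) (s≤s t≤) | true =
  let (s , s⊆ , #s) = select (λ i → b (suc i)) t t≤ in
  (true ∷ s) , (λ { zero _ → b0 ; (suc i) p → s⊆ i p }) , cong suc #s
select {suc k} b t       t≤       | false =
  let (s , s⊆ , #s) = select (λ i → b (suc i)) t t≤ in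
  (false ∷ s) , (λ { zero () ; (suc i) p → s⊆ i p }) , #s

split-≤-+ : ∀ {t} a b → t ≤ a + b →
  Σ ℕ λ t₁ → Σ ℕ λ t₂ → t₁ ≤ a × t₂ ≤ b × t₁ + t₂ ≡ t
split-≤-+ {t}     zero    b t≤b       = 0 , t , z≤n , t≤b , refl
split-≤-+ {zero}  (suc a) b _         = 0 , 0 , z≤n , z≤n , refl
split-≤-+ {suc t} (suc a) b (s≤s t≤)  =
  let (t₁ , t₂ , t₁≤ , t₂≤ , sum) = split-≤-+ a b t≤ in
  suc t₁ , t₂ , s≤s t₁≤ , t₂≤ , cong suc sum

≟-sound : ∀ {k} (a b : Fin k) → ⌊ a ≟ b ⌋ ≡ true → a ≡ b
≟-sound a b p with a ≟ b
≟-sound a b p  | yes a≡b = a≡b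
≟-sound a b () | no  _

-- Two of the objects (half-edges or markings) at a vertex v: the source
-- end of edge k, the target end of edge k, or marking j is chosen when the
-- corresponding Boolean is true.
record Selection {n e} (R : RawGraph n e) (v : Fin (nv R)) : Set where
  field
    atSrc atTgt : Fin e → Bool
    atMark      : Fin n → Bool
    src-at  : ∀ k → atSrc k ≡ true → src R k ≡ v
    tgt-at  : ∀ k → atTgt k ≡ true → tgt R k ≡ v
    mark-at : ∀ j → atMark j ≡ true → m R j ≡ v
    two     : count atSrc + count atTgt + count atMark ≡ 2

module _ {n e} (R : RawGraph n e) (v : Fin (nv R)) where
  private
    isS isT : Fin e → Bool
    isS k = ⌊ src R k ≟ v ⌋
    isT k = ⌊ tgt R k ≟ v ⌋
    isM : Fin n → Bool
    isM j = ⌊ m R j ≟ v ⌋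

    objects : val R v + marks R v ≡ (count isS + count isT) + count isM
    objects = cong (_+ marks R v) (sumF-+ (λ k → bi (isS k)) (λ k → bi (isT k)))

  selection : 2 ≤ val R v + marks R v → Selection R v
  selection two≤
    with split-≤-+ (count isS + count isT) (count isM) (subst (2 ≤_) objects two≤)
  ... | tST , tM , tST≤ , tM≤ , tST+tM with split-≤-+ (count isS) (count isT) tST≤
  ... | tS , tT , tS≤ , tT≤ , tS+tT
    with select isS tS tS≤ | select isT tT tT≤ | select isM tM tM≤
  ... | s , s⊆ , #s | t , t⊆ , #t | mk , mk⊆ , #mk = record
    { atSrc   = s
    ; atTgt   = t
    ; atMark  = mk
    ; src-at  = λ k p → ≟-sound (src R k) v (s⊆ k p)
    ; tgt-at  = λ k p → ≟-sound (tgt R k) v (t⊆ k p)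
    ; mark-at = λ j p → ≟-sound (m R j) v (mk⊆ j p)
    ; two     = trans (cong₂ _+_ (cong₂ _+_ #s #t) #mk)
                      (trans (cong (_+ tM) tS+tT) tST+tM) }

-- Vertex splitting

Weightless : ∀ {n e} → RawGraph n e → Set
Weightless R = ∀ u → w R u ≡ 0

genus-weightless : ∀ {g n e} (G : StableGraph g n e) → Weightless (raw G) → e + 1 ≡ g + nv (raw G)
genus-weightless {e = e} G w≡0 = begin
  e + 1                    ≡⟨ sym (+-identityʳ (e + 1)) ⟩
  e + 1 + 0                ≡⟨ cong (λ x → e + 1 + x) (sym (sumF-zero (w (raw G)) w≡0)) ⟩
  e + 1 + sumF (w (raw G)) ≡⟨ genus G ⟩
  _ ∎
  where open ≡-Reasoning

-- If a weightless stable graph could have one more vertex without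
-- violating the vertex bound, then by pigeonhole some vertex carries at
-- least four objects (half-edges and markings).
crowdedVertex : ∀ {g n e} (G : StableGraph g n e) → Weightless (raw G) →
  suc (nv (raw G)) + 2 ≤ 2 * g + n →
  Σ (Fin (nv (raw G))) λ v → 4 ≤ val (raw G) v + marks (raw G) v
crowdedVertex {g} {n} {e} G w≡0 room =
  sumF-pigeonhole 3 (λ u → val R u + marks R u) (+-cancelʳ-≤ 2 (suc (N * 3)) S (begin
    suc (N * 3) + 2          ≡⟨ solve 1 (λ x → con 1 :+ x :* con 3 :+ con 2
                                            := con 2 :* x :+ (con 1 :+ x :+ con 2)) refl N ⟩
    2 * N + (suc N + 2)      ≤⟨ +-monoʳ-≤ (2 * N) room ⟩
    2 * N + (2 * g + n)      ≡⟨ solve 3 (λ x g n → con 2 :* x :+ (con 2 :* g :+ n)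
                                            := con 2 :* (g :+ x) :+ n) refl N g n ⟩
    2 * (g + N) + n          ≡⟨ cong (λ x → 2 * x + n) (sym (genus-weightless G w≡0)) ⟩
    2 * (e + 1) + n          ≡⟨ solve 2 (λ e n → con 2 :* (e :+ con 1) :+ n
                                            := e :* con 2 :+ n :+ con 2) refl e n ⟩
    e * 2 + n + 2            ≡⟨ cong (_+ 2) (sym objects) ⟩
    S + 2                    ∎))
  where
  open ≤-Reasoning
  R : RawGraph n e
  R = raw G
  N S : ℕ
  N = nv R
  S = sumF (λ u → val R u + marks R u)
  objects : S ≡ e * 2 + n
  objects = trans (sumF-+ (val R) (marks R)) (cong₂ _+_ (sumF-val R) (sumF-marks R))

-- Insert a new vertex 0 before the old ones, which become suc u; an object
-- is moved to the new vertex exactly when it is selected.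
pick : ∀ {N} → Bool → Fin N → Fin (suc N)
pick b y = if b then zero else suc y

pick-zero : ∀ {N} b (y : Fin N) → [ pick b y ≟ᶠ zero ] ≡ bi b
pick-zero true  y = refl
pick-zero false y = refl

-- Stability of a vertex that loses two objects and gains one when c = 1
-- (the split vertex, which had at least four), and is untouched when c = 0.
lose-two-gain-one : ∀ {L L′ c} → L′ + c * 2 ≡ c + L →
  (c ≡ 0 × 3 ≤ L) ⊎ (c ≡ 1 × 4 ≤ L) → 3 ≤ L′
lose-two-gain-one {L} {L′} eq (inj₁ (refl , 3≤L)) = subst (3 ≤_) (trans (sym eq) (+-identityʳ L′)) 3≤L
lose-two-gain-one {L} {L′} eq (inj₂ (refl , 4≤L)) =
  +-cancelʳ-≤ 2 3 L′ (subst (5 ≤_) (sym eq) (s≤s 4≤L))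

-- Splitting a crowded vertex v of a weightless graph: a new vertex 0,
-- joined to v by a new edge labelled 0, receives the two selected objects
-- of v.
module VertexSplit {g n e : ℕ} (G : StableGraph g n e) (w≡0 : Weightless (raw G))
                   (v : Fin (nv (raw G))) (crowded : 4 ≤ val (raw G) v + marks (raw G) v)
                   (sel : Selection (raw G) v) where
  open Selection sel
  private
    R : RawGraph n e
    R = raw G
    N : ℕ
    N = nv R

  rawH : RawGraph n (suc e)
  rawH = record
    { nv  = suc N
    ; src = suc v ∷ (λ k → pick (atSrc k) (src R k))
    ; tgt = zero  ∷ (λ k → pick (atTgt k) (tgt R k))
    ; w   = λ _ → 0
    ; m   = λ j → pick (atMark j) (m R j) }

  -- the contraction of the new edge, identifying 0 with suc v
  rep : Fin (suc N) → Fin N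
  rep zero    = v
  rep (suc u) = u

  rep-pick : ∀ b y → (b ≡ true → y ≡ v) → rep (pick b y) ≡ y
  rep-pick true  y at = sym (at refl)
  rep-pick false y at = refl

  -- Connectivity: every vertex x is joined to suc (rep x), and each old edge
  -- still joins the representatives of its ends.
  ReachH : Fin (suc N) → Fin (suc N) → Set
  ReachH = Reach (src rawH) (tgt rawH)

  to-rep : ∀ x → ReachH x (suc (rep x))
  to-rep zero    = bwd zero here
  to-rep (suc u) = here

  from-rep : ∀ x → ReachH (suc (rep x)) x
  from-rep zero    = fwd zero here
  from-rep (suc u) = here

  to-rep≡ : ∀ x {y} → rep x ≡ y → ReachH x (suc y)
  to-rep≡ x refl = to-rep x

  from-rep≡ : ∀ x {y} → rep x ≡ y → ReachH (suc y) x
  from-rep≡ x refl = from-rep x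

  reach-lift : ∀ {a b} → Reach (src R) (tgt R) a b → ReachH (suc a) (suc b)
  reach-lift here = here
  reach-lift (fwd k r) =
    Reach-trans (from-rep≡ _ (rep-pick (atSrc k) (src R k) (src-at k)))
      (fwd (suc k) (Reach-trans (to-rep≡ _ (rep-pick (atTgt k) (tgt R k) (tgt-at k))) (reach-lift r)))
  reach-lift (bwd k r) =
    Reach-trans (from-rep≡ _ (rep-pick (atTgt k) (tgt R k) (tgt-at k)))
      (bwd (suc k) (Reach-trans (to-rep≡ _ (rep-pick (atSrc k) (src R k) (src-at k))) (reach-lift r)))

  connectedH : ∀ a b → ReachH a b
  connectedH a b =
    Reach-trans (to-rep a) (Reach-trans (reach-lift (proj₂ (connected G) (rep a) (rep b))) (from-rep b))

  -- Object counts at an old vertex suc u: an object moved away from v is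
  -- missing there, and only there (c = [v = u] records whether u is v).
  relocated : ∀ b y u → (b ≡ true → y ≡ v) →
    [ pick b y ≟ᶠ suc u ] + [ v ≟ᶠ u ] * bi b ≡ [ y ≟ᶠ u ]
  relocated true  y u at = trans (*-identityʳ _) (cong (λ z → [ z ≟ᶠ u ]) (sym (at refl)))
  relocated false y u _  = begin
    [ suc y ≟ᶠ suc u ] + [ v ≟ᶠ u ] * 0 ≡⟨ cong (λ x → [ suc y ≟ᶠ suc u ] + x) (*-zeroʳ [ v ≟ᶠ u ]) ⟩
    [ suc y ≟ᶠ suc u ] + 0              ≡⟨ +-identityʳ _ ⟩
    [ suc y ≟ᶠ suc u ]                  ≡⟨ ind-suc y u ⟩
    [ y ≟ᶠ u ] ∎
    where open ≡-Reasoning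

  relocated-sum : ∀ {k} (b : Fin k → Bool) (y : Fin k → Fin N) → (∀ i → b i ≡ true → y i ≡ v) →
    ∀ u → sumF (λ i → [ pick (b i) (y i) ≟ᶠ suc u ]) + [ v ≟ᶠ u ] * count b
        ≡ sumF (λ i → [ y i ≟ᶠ u ])
  relocated-sum b y at u = begin
    sumF (λ i → [ pick (b i) (y i) ≟ᶠ suc u ]) + [ v ≟ᶠ u ] * count b
      ≡⟨ cong (λ x → sumF (λ i → [ pick (b i) (y i) ≟ᶠ suc u ]) + x)
              (sym (sumF-*ˡ [ v ≟ᶠ u ] (λ i → bi (b i)))) ⟩
    sumF (λ i → [ pick (b i) (y i) ≟ᶠ suc u ]) + sumF (λ i → [ v ≟ᶠ u ] * bi (b i))
      ≡⟨ sym (sumF-+ (λ i → [ pick (b i) (y i) ≟ᶠ suc u ]) (λ i → [ v ≟ᶠ u ] * bi (b i))) ⟩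
    sumF (λ i → [ pick (b i) (y i) ≟ᶠ suc u ] + [ v ≟ᶠ u ] * bi (b i))
      ≡⟨ sumF-cong (λ i → relocated (b i) (y i) u (at i)) ⟩
    sumF (λ i → [ y i ≟ᶠ u ]) ∎
    where open ≡-Reasoning

  val-old : ∀ u → val rawH (suc u) + [ v ≟ᶠ u ] * (count atSrc + count atTgt) ≡ [ v ≟ᶠ u ] + val R u
  val-old u = begin
    ([ suc v ≟ᶠ suc u ] + 0) + sumF (λ k → hs k + ht k) + c * (count atSrc + count atTgt)
      ≡⟨ cong₂ (λ a x → (a + 0) + x + c * (count atSrc + count atTgt)) (ind-suc v u) (sumF-+ hs ht) ⟩
    (c + 0) + (sumF hs + sumF ht) + c * (count atSrc + count atTgt)
      ≡⟨ solve 5 (λ c a b s t → (c :+ con 0) :+ (a :+ b) :+ c :* (s :+ t)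
                              := c :+ ((a :+ c :* s) :+ (b :+ c :* t)))
               refl c (sumF hs) (sumF ht) (count atSrc) (count atTgt) ⟩
    c + ((sumF hs + c * count atSrc) + (sumF ht + c * count atTgt))
      ≡⟨ cong₂ (λ a b → c + (a + b)) (relocated-sum atSrc (src R) src-at u)
                                      (relocated-sum atTgt (tgt R) tgt-at u) ⟩
    c + (sumF (λ k → [ src R k ≟ᶠ u ]) + sumF (λ k → [ tgt R k ≟ᶠ u ]))
      ≡⟨ cong (λ x → c + x)
              (sym (sumF-+ (λ k → [ src R k ≟ᶠ u ]) (λ k → [ tgt R k ≟ᶠ u ]))) ⟩
    c + val R u ∎
    where
    open ≡-Reasoning
    c : ℕ
    c = [ v ≟ᶠ u ]
    hs ht : Fin e → ℕ
    hs k = [ pick (atSrc k) (src R k) ≟ᶠ suc u ]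
    ht k = [ pick (atTgt k) (tgt R k) ≟ᶠ suc u ]

  -- The vertex suc v lost the two selected objects and gained the new edge.
  load-old : ∀ u → (val rawH (suc u) + marks rawH (suc u)) + [ v ≟ᶠ u ] * 2
                 ≡ [ v ≟ᶠ u ] + (val R u + marks R u)
  load-old u = begin
    (vH + mH) + c * 2
      ≡⟨ cong (λ x → (vH + mH) + c * x) (sym two) ⟩
    (vH + mH) + c * (count atSrc + count atTgt + count atMark)
      ≡⟨ solve 5 (λ a b c st m → (a :+ b) :+ c :* (st :+ m) := (a :+ c :* st) :+ (b :+ c :* m))
               refl vH mH c (count atSrc + count atTgt) (count atMark) ⟩
    (vH + c * (count atSrc + count atTgt)) + (mH + c * count atMark)
      ≡⟨ cong₂ _+_ (val-old u) (relocated-sum atMark (m R) mark-at u) ⟩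
    (c + val R u) + marks R u
      ≡⟨ +-assoc c (val R u) (marks R u) ⟩
    c + (val R u + marks R u) ∎
    where
    open ≡-Reasoning
    c vH mH : ℕ
    c = [ v ≟ᶠ u ]
    vH = val rawH (suc u)
    mH = marks rawH (suc u)

  -- The new vertex carries the two selected objects and one end of the new edge.
  load-new : val rawH zero + marks rawH zero ≡ 3
  load-new = begin
    (0 + 1) + sumF (λ k → [ pick (atSrc k) (src R k) ≟ᶠ zero ] + [ pick (atTgt k) (tgt R k) ≟ᶠ zero ])
      + sumF (λ j → [ pick (atMark j) (m R j) ≟ᶠ zero ])
      ≡⟨ cong₂ (λ a b → 1 + a + b)
           (trans (sumF-cong (λ k → cong₂ _+_ (pick-zero (atSrc k) (src R k))
                                               (pick-zero (atTgt k) (tgt R k))))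
                  (sumF-+ (λ k → bi (atSrc k)) (λ k → bi (atTgt k))))
           (sumF-cong (λ j → pick-zero (atMark j) (m R j))) ⟩
    1 + (count atSrc + count atTgt) + count atMark
      ≡⟨ +-assoc 1 (count atSrc + count atTgt) (count atMark) ⟩
    1 + (count atSrc + count atTgt + count atMark)
      ≡⟨ cong suc two ⟩
    3 ∎
    where open ≡-Reasoning

  stableH : ∀ x → 3 ≤ 2 * w rawH x + val rawH x + marks rawH x
  stableH zero    = ≤-reflexive (sym load-new)
  stableH (suc u) with ind-cases v u
  ... | inj₁ (c≡0 , _) = lose-two-gain-one (load-old u) (inj₁ (c≡0 , old-stable))
    where
    old-stable : 3 ≤ val R u + marks R u
    old-stable = subst (λ z → 3 ≤ 2 * z + val R u + marks R u) (w≡0 u) (stable G u)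
  ... | inj₂ (c≡1 , refl) = lose-two-gain-one (load-old u) (inj₂ (c≡1 , crowded))

  H : StableGraph g n (suc e)
  H = record
    { raw       = rawH
    ; connected = s≤s z≤n , connectedH
    ; genus     = begin
        suc e + 1 + sumF {suc N} (λ _ → 0) ≡⟨ cong (λ x → suc e + 1 + x)
                                                    (sumF-zero {suc N} (λ _ → 0) (λ _ → refl)) ⟩
        suc e + 1 + 0                      ≡⟨ +-identityʳ (suc e + 1) ⟩
        suc (e + 1)                        ≡⟨ cong suc (genus-weightless G w≡0) ⟩
        suc (g + N)                        ≡⟨ sym (+-suc g N) ⟩
        g + suc N ∎
    ; stable    = stableH }
    where open ≡-Reasoning

  merge-rep : ∀ ne x → merge (suc v) zero ne x ≡ rep x
  merge-rep ne zero    = refl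
  merge-rep ne (suc x) = refl

  contract-pick : ∀ ne b y → (b ≡ true → y ≡ v) → merge (suc v) zero ne (pick b y) ≡ y
  contract-pick ne b y at = trans (merge-rep ne (pick b y)) (rep-pick b y at)

  contracts : Iso (faceMap zero rawH) R
  contracts = record
    { σ       = ↔-id _
    ; weight  = λ u → trans (w≡0 u)
                        (sym (sumF-zero _ (λ x → if-eta ⌊ merge (suc v) zero (λ ()) x ≟ u ⌋)))
    ; marking = λ j → sym (contract-pick _ (atMark j) (m R j) (mark-at j))
    ; edges   = λ k → inj₁ ( sym (contract-pick _ (atSrc k) (src R k) (src-at k))
                           , sym (contract-pick _ (atTgt k) (tgt R k) (tgt-at k))) }

-- Facets of Vⁱ

-- A facet of Vⁱ is weightless: blowing up a vertex of positive weight
-- would exhibit it as a face of a graph in Vⁱ with the same vertices.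
facet-weightless : ∀ {g n e i} (G : StableGraph g n e) → InV i G → FacetV i G → Weightless (raw G)
facet-weightless G inV facet u with 1 ≤? w (raw G) u
... | yes w-pos = ⊥-elim (facet (zero , LoopBlowUp.H G u w-pos , inV ,
                                  LoopBlowUp.contracts G u w-pos))
... | no  w≯0   = n≤0⇒n≡0 (≮⇒≥ w≯0)

-- A facet of Vⁱ, for i within the vertex bound, has exactly i vertices:
-- with fewer, splitting a crowded vertex would exhibit it as a face of a
-- graph in Vⁱ with one vertex more.
facet-full : ∀ {g n e i} (G : StableGraph g n e) → i ≤ 2 * g + n ∸ 2 →
  InV i G → FacetV i G → nv (raw G) ≡ i
facet-full {g} {n} G i≤bound inV facet with m≤n⇒m<n∨m≡n inV
... | inj₂ N≡i = N≡i
... | inj₁ N<i = ⊥-elim (facet (zero , VertexSplit.H G w≡0 v crowded sel , N<i ,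
                                 VertexSplit.contracts G w≡0 v crowded sel))
  where
  w≡0 : Weightless (raw G)
  w≡0 = facet-weightless G inV facet
  room : suc (nv (raw G)) + 2 ≤ 2 * g + n
  room = m≤o∸n⇒m+n≤o (suc (nv (raw G))) (m+n≤o⇒n≤o (nv (raw G)) (vertexBound G))
                     (≤-trans N<i i≤bound)
  v : Fin (nv (raw G))
  v = proj₁ (crowdedVertex G w≡0 room)
  crowded : 4 ≤ val (raw G) v + marks (raw G) v
  crowded = proj₂ (crowdedVertex G w≡0 room)
  sel : Selection (raw G) v
  sel = selection (raw G) v (≤-trans (s≤s (s≤s z≤n)) crowded)

dimension : ∀ g i {e} → e + 1 ≡ g + i → (+ e) ℤ.- + 1 ≡ (+ g ℤ.+ + i) ℤ.- + 2
dimension g i {e} e+1≡g+i =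
  trans (sym (ℤP.[1+m]⊖[1+n]≡m⊖n e 1)) (cong (ℤ._⊖ 2) (trans (+-comm 1 e) e+1≡g+i))

proposition3p2 : (g n : ℕ) → 0 < 3 * g + n ∸ 3 →
    ((i : ℕ) → 1 ≤ i → i ≤ 2 * g + n ∸ 2 →
       PureV g n i ((+ g ℤ.+ + i) ℤ.- + 2))
    × ((e : ℕ) (G : StableGraph g n e) → nv (raw G) ≤ 2 * g + n ∸ 2)
proposition3p2 g n _ = pure , λ e G → m+n≤o⇒m≤o∸n (nv (raw G)) (vertexBound G)
  where
  -- a facet is weightless with i vertices, so the genus formula fixes |E|
  pure : (i : ℕ) → 1 ≤ i → i ≤ 2 * g + n ∸ 2 → PureV g n i ((+ g ℤ.+ + i) ℤ.- + 2)
  pure i _ i≤bound e G inV facet = dimension g i (begin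
    e + 1          ≡⟨ genus-weightless G (facet-weightless G inV facet) ⟩
    g + nv (raw G) ≡⟨ cong (λ x → g + x) (facet-full G i≤bound inV facet) ⟩
    g + i          ∎)
    where open ≡-Reasoning
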